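{- For every integer $m\geq 3$, $\lambda_1^1(P_m \times C_{14})=5$.
   Context: For a graph $G$, an $L(1,1)$-labeling with labels in $\{0,1,\dots,p\}$ is a function $l:V(G)\to\{0,1,\dots,p\}$ such that $l(u)\neq l(v)$ whenever the distance $d(u,v)$ is $1$ or $2$. $\lambda_1^1(G)$ denotes the least $p$ for which $G$ admits such a labeling. $P_m$ denotes the path with $m$ vertices and $C_n$ the cycle with $n$ vertices. The direct product $G\times H$ has vertex set $V(G)\times V(H)$, with $(x_1,x_2)$ adjacent to $(y_1,y_2)$ iff $x_1y_1\in E(G)$ and $x_2y_2\in E(H)$. -}

module Defs where

open import Data.Nat using (ℕ; suc; _+_; _≤_; _<_; NonZero)
open import Data.Nat.DivMod using (_%_)
open import Data.Fin using (Fin; toℕ)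
open import Data.Product using (_×_; _,_; ∃-syntax; Σ-syntax)
open import Data.Sum using (_⊎_)
open import Relation.Binary.PropositionalEquality using (_≡_; _≢_)
open import Relation.Nullary using (¬_)

record Graph : Set₁ where
  field
    V   : Set
    Adj : V → V → Set
open Graph public

Path : ℕ → Graph
Path m = record { V = Fin m ; Adj = λ i j → (suc (toℕ i) ≡ toℕ j) ⊎ (suc (toℕ j) ≡ toℕ i) }

Cycle : (n : ℕ) → .{{NonZero n}} → Graph
Cycle n = record { V = Fin n ; Adj = λ i j → (suc (toℕ i) % n ≡ toℕ j)
                                            ⊎ (suc (toℕ j) % n ≡ toℕ i) }

_×ᴳ_ : Graph → Graph → Graph
G ×ᴳ H = record { V = V G × V H
                ; Adj = λ { (x₁ , x₂) (y₁ , y₂) → Adj G x₁ y₁ × Adj H x₂ y₂ } }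

Dist1 : (G : Graph) → V G → V G → Set
Dist1 G u v = u ≢ v × Adj G u v

Dist2 : (G : Graph) → V G → V G → Set
Dist2 G u v = u ≢ v × ¬ Adj G u v × ∃[ w ] (Adj G u w × Adj G w v)

IsL11Labeling : (G : Graph) (p : ℕ) → (V G → Fin (suc p)) → Set
IsL11Labeling G p l = ∀ u v → (Dist1 G u v ⊎ Dist2 G u v) → l u ≢ l v

HasL11Labeling : Graph → ℕ → Set
HasL11Labeling G p = Σ[ l ∈ (V G → Fin (suc p)) ] IsL11Labeling G p l

λ₁¹≡ : Graph → ℕ → Set
λ₁¹≡ G k = HasL11Labeling G k × (∀ p → p < k → ¬ HasL11Labeling G p)

-- Upper bound: rows of P_m are labelled 5-periodically by a 5 × 14 table over {0,…,5}
-- (found by computer search), and the L(1,1) condition is checked over all phases.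
--
-- Lower bound: in rows 0, 1, 2 the closed neighbourhood of a middle-row vertex is a clique
-- of the square graph, so with five labels each such window
--   (0, 2k), (2, 2k), (1, 2k+1), (0, 2k+2), (2, 2k+2)
-- is rainbow.  Writing c_k for the label of its centre and A_k for the labels of (0, 2k) and
-- (2, 2k), comparing consecutive windows gives c_k ∈ A_{k+2} and c_{k+1} ∈ A_k, whence
-- c_k ≠ c_{k+d} for d = 1, 2, 4.  These are the squares modulo 7, so together with their
-- negatives they are all nonzero residues: the seven centres around C₁₄ (c_{k+7} = c_k)
-- would need seven distinct labels.
module Submission where

open import Defs
open import Data.Nat as ℕ using (ℕ; zero; suc; _+_; _*_; _∸_; _≤_; _<_; s≤s)
open import Data.Nat.Properties as ℕ using (<-cmp; <⇒≤; m∸n+n≡m; m<n⇒0<n∸m)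
open import Data.Nat.DivMod using (_mod_)
open import Data.Fin as Fin using (Fin; toℕ; inject≤)
open import Data.Fin.Properties
  using (toℕ-fromℕ<; toℕ-injective; toℕ<n; inject≤-injective; injective⇒≤; all?; any?)
open import Data.Fin.Patterns using (0F; 1F; 2F; 3F; 4F; 5F)
open import Data.Vec.Functional using (Vector; []; _∷_)
open import Data.Product as Product using (_×_; _,_; ∃-syntax)
open import Data.Product.Properties using (≡-dec)
open import Data.Sum using (_⊎_; inj₁; inj₂; swap)
open import Data.Empty using (⊥-elim)
open import Function using (_∘_)
open import Function.Definitions using (Injective)
open import Relation.Binary.Definitions using (Decidable; Symmetric; tri<; tri≈; tri>)
open import Relation.Binary.PropositionalEquality
open import Relation.Nullary using (¬_; yes; no; contradiction)
open import Relation.Nullary.Decidable using (_×-dec_; _⊎-dec_; _→-dec_; ¬?; from-yes; from-no)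

path-sym : ∀ {m} → Symmetric (Adj (Path m))
path-sym = swap

cycle-sym : ∀ {n} .{{_ : ℕ.NonZero n}} → Symmetric (Adj (Cycle n))
cycle-sym = swap

×ᴳ-sym : ∀ {G H} → Symmetric (Adj G) → Symmetric (Adj H) → Symmetric (Adj (G ×ᴳ H))
×ᴳ-sym G-sym H-sym = Product.map G-sym H-sym

path-adj? : ∀ {m} → Decidable (Adj (Path m))
path-adj? i j = (suc (toℕ i) ℕ.≟ toℕ j) ⊎-dec (suc (toℕ j) ℕ.≟ toℕ i)

cycle-adj? : ∀ {n} .{{_ : ℕ.NonZero n}} → Decidable (Adj (Cycle n))
cycle-adj? {n} i j = (suc (toℕ i) ℕ.% n ℕ.≟ toℕ j) ⊎-dec (suc (toℕ j) ℕ.% n ℕ.≟ toℕ i)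

×ᴳ-adj? : ∀ {G H} → Decidable (Adj G) → Decidable (Adj H) → Decidable (Adj (G ×ᴳ H))
×ᴳ-adj? G? H? (x₁ , x₂) (y₁ , y₂) = G? x₁ y₁ ×-dec H? x₂ y₂

module _ {G : Graph} (adj? : Decidable (Adj G)) (adj-sym : Symmetric (Adj G))
         {p : ℕ} {l : V G → Fin (suc p)} (valid : IsL11Labeling G p l) where

  adjacent⇒label≢ : ∀ {u v} → u ≢ v → Adj G u v → l u ≢ l v
  adjacent⇒label≢ u≢v uv = valid _ _ (inj₁ (u≢v , uv))

  common-neighbour⇒label≢ : ∀ {u v w} → u ≢ w → Adj G u v → Adj G v w → l u ≢ l w
  common-neighbour⇒label≢ {u} {v} {w} u≢w uv vw with adj? u w
  ... | yes uw = adjacent⇒label≢ u≢w uw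
  ... | no ¬uw = valid u w (inj₂ (u≢w , ¬uw , v , uv , vw))

  closed-neighbours⇒label≢ : ∀ {v u w} → u ≢ w → u ≡ v ⊎ Adj G v u → w ≡ v ⊎ Adj G v w → l u ≢ l w
  closed-neighbours⇒label≢ u≢w (inj₁ refl) (inj₁ refl) = ⊥-elim (u≢w refl)
  closed-neighbours⇒label≢ u≢w (inj₁ refl) (inj₂ vw)   = adjacent⇒label≢ u≢w vw
  closed-neighbours⇒label≢ u≢w (inj₂ vu)   (inj₁ refl) = adjacent⇒label≢ u≢w (adj-sym vu)
  closed-neighbours⇒label≢ u≢w (inj₂ vu)   (inj₂ vw)   = common-neighbour⇒label≢ u≢w (adj-sym vu) vw

  closed-neighbourhood⇒injective : ∀ {n v} (w : Fin n → V G) → Injective _≡_ _≡_ w →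
    (∀ i → w i ≡ v ⊎ Adj G v (w i)) → Injective _≡_ _≡_ (l ∘ w)
  closed-neighbourhood⇒injective w w-injective near {i} {j} eq with i Fin.≟ j
  ... | yes i≡j = i≡j
  ... | no i≢j  = ⊥-elim (closed-neighbours⇒label≢ (i≢j ∘ w-injective) (near i) (near j) eq)

hasL11Labeling-mono : ∀ {G p q} → p ≤ q → HasL11Labeling G p → HasL11Labeling G q
hasL11Labeling-mono p≤q (l , valid) =
  (λ u → inject≤ (l u) (s≤s p≤q)) , λ u v d eq → valid u v d (inject≤-injective _ _ _ _ eq)

injective⇒onto : ∀ {n} {f : Fin n → Fin n} → Injective _≡_ _≡_ f → ∀ y → ∃[ i ] f i ≡ y
injective⇒onto {n} {f} f-injective y with any? (λ i → f i Fin.≟ y)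
... | yes hit = hit
... | no miss = contradiction (injective⇒≤ extension-injective) (ℕ.n≮n n)
  where
  extension-injective : Injective _≡_ _≡_ (y ∷ f)
  extension-injective {Fin.zero}  {Fin.zero}  _ = refl
  extension-injective {Fin.zero}  {Fin.suc j} e = ⊥-elim (miss (j , sym e))
  extension-injective {Fin.suc i} {Fin.zero}  e = ⊥-elim (miss (i , e))
  extension-injective {Fin.suc i} {Fin.suc j} e = cong Fin.suc (f-injective e)

next : ∀ {n} → Fin (suc n) → Fin (suc n)
next {n} i = suc (toℕ i) mod suc n

next-adjacent : ∀ {n} (i : Fin (suc n)) → Adj (Cycle (suc n)) i (next i)
next-adjacent i = inj₁ (sym (toℕ-fromℕ< _))

-- x mod (1 + n), defined by counting so that cyclic (suc x) is definitionally next (cyclic x).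
cyclic : ∀ {n} → ℕ → Fin (suc n)
cyclic zero    = Fin.zero
cyclic (suc x) = next (cyclic x)

cyclic-periodic : ∀ x → cyclic {13} (14 + x) ≡ cyclic x
cyclic-periodic zero    = refl
cyclic-periodic (suc x) = cong next (cyclic-periodic x)

-- A_k = {top k, bottom k} and c_k = centre k.
module RainbowChain (top bottom centre : ℕ → Fin 5) where

  window : ℕ → Vector (Fin 5) 5
  window k = top k ∷ bottom k ∷ centre k ∷ top (suc k) ∷ bottom (suc k) ∷ []

  InPair : ℕ → Fin 5 → Set
  InPair k v = top k ≡ v ⊎ bottom k ≡ v

  module _ (rainbow : ∀ k → Injective _≡_ _≡_ (window k))
           (consecutive-centres-≢ : ∀ k → centre k ≢ centre (suc k)) where

    window-covers : ∀ k v → InPair k v ⊎ centre k ≡ v ⊎ InPair (suc k) v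
    window-covers k v with injective⇒onto (rainbow k) v
    ... | 0F , e = inj₁ (inj₁ e)
    ... | 1F , e = inj₁ (inj₂ e)
    ... | 2F , e = inj₂ (inj₁ e)
    ... | 3F , e = inj₂ (inj₂ (inj₁ e))
    ... | 4F , e = inj₂ (inj₂ (inj₂ e))

    window-≢ : ∀ k (i j : Fin 5) → i ≢ j → window k i ≢ window k j
    window-≢ k i j i≢j = i≢j ∘ rainbow k

    pair-∌-centre : ∀ k → ¬ InPair k (centre k)
    pair-∌-centre k (inj₁ e) = window-≢ k 0F 2F (λ ()) e
    pair-∌-centre k (inj₂ e) = window-≢ k 1F 2F (λ ()) e

    next-pair-∌-centre : ∀ k → ¬ InPair (suc k) (centre k)
    next-pair-∌-centre k (inj₁ e) = window-≢ k 3F 2F (λ ()) e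
    next-pair-∌-centre k (inj₂ e) = window-≢ k 4F 2F (λ ()) e

    consecutive-pairs-disjoint : ∀ k {v} → InPair k v → ¬ InPair (suc k) v
    consecutive-pairs-disjoint k (inj₁ p) (inj₁ q) = window-≢ k 0F 3F (λ ()) (trans p (sym q))
    consecutive-pairs-disjoint k (inj₁ p) (inj₂ q) = window-≢ k 0F 4F (λ ()) (trans p (sym q))
    consecutive-pairs-disjoint k (inj₂ p) (inj₁ q) = window-≢ k 1F 3F (λ ()) (trans p (sym q))
    consecutive-pairs-disjoint k (inj₂ p) (inj₂ q) = window-≢ k 1F 4F (λ ()) (trans p (sym q))

    centre-∈-pair₊₂ : ∀ k → InPair (2 + k) (centre k)
    centre-∈-pair₊₂ k with window-covers (suc k) (centre k)
    ... | inj₁ p        = ⊥-elim (next-pair-∌-centre k p)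
    ... | inj₂ (inj₁ e) = ⊥-elim (consecutive-centres-≢ k (sym e))
    ... | inj₂ (inj₂ p) = p

    next-centre-∈-pair : ∀ k → InPair k (centre (suc k))
    next-centre-∈-pair k with window-covers k (centre (suc k))
    ... | inj₁ p        = p
    ... | inj₂ (inj₁ e) = ⊥-elim (consecutive-centres-≢ k e)
    ... | inj₂ (inj₂ p) = ⊥-elim (pair-∌-centre (suc k) p)

    centre-≢-centre₊₂ : ∀ k → centre k ≢ centre (2 + k)
    centre-≢-centre₊₂ k eq = pair-∌-centre (2 + k) (subst (InPair (2 + k)) eq (centre-∈-pair₊₂ k))

    centre-≢-centre₊₄ : ∀ k → centre k ≢ centre (4 + k)
    centre-≢-centre₊₄ k eq = consecutive-pairs-disjoint (2 + k) (centre-∈-pair₊₂ k)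
      (subst (InPair (3 + k)) (sym eq) (next-centre-∈-pair (3 + k)))

    module _ (periodic : ∀ k → centre (7 + k) ≡ centre k) where

      centre-≢-centre₊ : ∀ k d → 0 < d → d < 7 → centre k ≢ centre (d + k)
      centre-≢-centre₊ k 1 _ _    = consecutive-centres-≢ k
      centre-≢-centre₊ k 2 _ _    = centre-≢-centre₊₂ k
      centre-≢-centre₊ k 3 _ _ eq = centre-≢-centre₊₄ (3 + k) (trans (sym eq) (sym (periodic k)))
      centre-≢-centre₊ k 4 _ _    = centre-≢-centre₊₄ k
      centre-≢-centre₊ k 5 _ _ eq = centre-≢-centre₊₂ (5 + k) (trans (sym eq) (sym (periodic k)))
      centre-≢-centre₊ k 6 _ _ eq = consecutive-centres-≢ (6 + k) (trans (sym eq) (sym (periodic k)))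
      centre-≢-centre₊ k (suc (suc (suc (suc (suc (suc (suc _))))))) _
        (s≤s (s≤s (s≤s (s≤s (s≤s (s≤s (s≤s ())))))))

      centres-below-7-≢ : ∀ {a b} → a < b → b < 7 → centre a ≢ centre b
      centres-below-7-≢ {a} {b} a<b b<7 = subst (λ c → centre a ≢ centre c) (m∸n+n≡m (<⇒≤ a<b))
        (centre-≢-centre₊ a (b ∸ a) (m<n⇒0<n∸m a<b) (ℕ.≤-<-trans (ℕ.m∸n≤m b a) b<7))

      centres-below-7-injective : Injective _≡_ _≡_ (λ (i : Fin 7) → centre (toℕ i))
      centres-below-7-injective {i} {j} eq with <-cmp (toℕ i) (toℕ j)
      ... | tri< i<j _ _ = ⊥-elim (centres-below-7-≢ i<j (toℕ<n j) eq)
      ... | tri≈ _ i≡j _ = toℕ-injective i≡j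
      ... | tri> _ _ j<i = ⊥-elim (centres-below-7-≢ j<i (toℕ<n i) (sym eq))

    centres-not-7-periodic : ¬ (∀ k → centre (7 + k) ≡ centre k)
    centres-not-7-periodic periodic = from-no (7 ℕ.≤? 5) (injective⇒≤ (centres-below-7-injective periodic))

tile : Fin 5 → Fin 14 → Fin 6
tile = (0F ∷ 4F ∷ 1F ∷ 2F ∷ 3F ∷ 0F ∷ 4F ∷ 1F ∷ 2F ∷ 0F ∷ 5F ∷ 1F ∷ 2F ∷ 3F ∷ [])
     ∷ (1F ∷ 2F ∷ 3F ∷ 0F ∷ 4F ∷ 1F ∷ 2F ∷ 3F ∷ 5F ∷ 4F ∷ 2F ∷ 3F ∷ 0F ∷ 4F ∷ [])
     ∷ (3F ∷ 0F ∷ 4F ∷ 1F ∷ 2F ∷ 3F ∷ 0F ∷ 4F ∷ 1F ∷ 3F ∷ 0F ∷ 5F ∷ 1F ∷ 2F ∷ [])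
     ∷ (4F ∷ 1F ∷ 2F ∷ 3F ∷ 0F ∷ 4F ∷ 1F ∷ 2F ∷ 0F ∷ 5F ∷ 4F ∷ 2F ∷ 3F ∷ 0F ∷ [])
     ∷ (2F ∷ 3F ∷ 0F ∷ 4F ∷ 1F ∷ 2F ∷ 3F ∷ 5F ∷ 4F ∷ 1F ∷ 3F ∷ 0F ∷ 4F ∷ 1F ∷ [])
     ∷ []

tile-adjacent-phases : ∀ s b d → Adj (Cycle 14) b d → tile s b ≢ tile (next s) d
tile-adjacent-phases = from-yes (all? λ s → all? λ b → all? λ d →
  cycle-adj? b d →-dec ¬? (tile s b Fin.≟ tile (next s) d))

tile-same-phase : ∀ s b e d → b ≢ d → Adj (Cycle 14) b e → Adj (Cycle 14) e d → tile s b ≢ tile s d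
tile-same-phase = from-yes (all? λ s → all? λ b → all? λ e → all? λ d →
  ¬? (b Fin.≟ d) →-dec (cycle-adj? b e →-dec (cycle-adj? e d →-dec ¬? (tile s b Fin.≟ tile s d))))

tile-phases-two-apart : ∀ s b e d → Adj (Cycle 14) b e → Adj (Cycle 14) e d →
  tile s b ≢ tile (next (next s)) d
tile-phases-two-apart = from-yes (all? λ s → all? λ b → all? λ e → all? λ d →
  cycle-adj? b e →-dec (cycle-adj? e d →-dec ¬? (tile s b Fin.≟ tile (next (next s)) d)))

tile-adjacent-rows : ∀ {x z} b d → suc x ≡ z → Adj (Cycle 14) b d → tile (cyclic x) b ≢ tile (cyclic z) d
tile-adjacent-rows {x} b d refl = tile-adjacent-phases (cyclic x) b d

tile-rows-two-apart : ∀ {x z} b e d → z ≡ 2 + x → Adj (Cycle 14) b e → Adj (Cycle 14) e d →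
  tile (cyclic x) b ≢ tile (cyclic z) d
tile-rows-two-apart {x} b e d refl = tile-phases-two-apart (cyclic x) b e d

path-two-step : ∀ {x y z} → suc x ≡ y ⊎ suc y ≡ x → suc y ≡ z ⊎ suc z ≡ y → z ≡ 2 + x ⊎ x ≡ 2 + z ⊎ x ≡ z
path-two-step (inj₁ refl) (inj₁ refl) = inj₁ refl
path-two-step (inj₁ refl) (inj₂ q)    = inj₂ (inj₂ (sym (ℕ.suc-injective q)))
path-two-step (inj₂ refl) (inj₁ refl) = inj₂ (inj₂ refl)
path-two-step (inj₂ refl) (inj₂ refl) = inj₂ (inj₁ refl)

stripLabel : ∀ {m} → Fin m × Fin 14 → Fin 6
stripLabel (a , b) = tile (cyclic (toℕ a)) b

stripLabel-valid : ∀ m → IsL11Labeling (Path m ×ᴳ Cycle 14) 5 stripLabel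
stripLabel-valid m (a , b) (c , d) (inj₁ (_ , inj₁ ac , bd)) = tile-adjacent-rows b d ac bd
stripLabel-valid m (a , b) (c , d) (inj₁ (_ , inj₂ ca , bd)) = tile-adjacent-rows d b ca (cycle-sym bd) ∘ sym
stripLabel-valid m (a , b) (c , d) (inj₂ (u≢v , _ , (_ , f) , (ae , bf) , (ec , fd)))
  with path-two-step ae ec
... | inj₁ c≡2+a        = tile-rows-two-apart b f d c≡2+a bf fd
... | inj₂ (inj₁ a≡2+c) = tile-rows-two-apart d f b a≡2+c (cycle-sym fd) (cycle-sym bf) ∘ sym
... | inj₂ (inj₂ a≡c) with toℕ-injective a≡c
...   | refl = tile-same-phase (cyclic (toℕ a)) b f d (u≢v ∘ cong (a ,_)) bf fd

module LowerBound (M : ℕ) where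

  Strip : Graph
  Strip = Path (3 + M) ×ᴳ Cycle 14

  window-at : Fin 14 → Vector (V Strip) 5
  window-at b = (0F , b) ∷ (2F , b) ∷ (1F , next b) ∷ (0F , next (next b)) ∷ (2F , next (next b)) ∷ []

  window-at-injective : ∀ b i j → window-at b i ≡ window-at b j → i ≡ j
  window-at-injective = from-yes (all? λ b → all? λ i → all? λ j →
    ≡-dec Fin._≟_ Fin._≟_ (window-at b i) (window-at b j) →-dec (i Fin.≟ j))

  window-at-centred : ∀ b i → window-at b i ≡ window-at b 2F ⊎ Adj Strip (window-at b 2F) (window-at b i)
  window-at-centred b 0F = inj₂ (inj₂ refl , cycle-sym (next-adjacent b))
  window-at-centred b 1F = inj₂ (inj₁ refl , cycle-sym (next-adjacent b))
  window-at-centred b 2F = inj₁ refl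
  window-at-centred b 3F = inj₂ (inj₂ refl , next-adjacent (next b))
  window-at-centred b 4F = inj₂ (inj₁ refl , next-adjacent (next b))

  consecutive-centres-distinct : ∀ b → window-at b 2F ≢ window-at (next (next b)) 2F
  consecutive-centres-distinct = from-yes (all? λ b →
    ¬? (≡-dec Fin._≟_ Fin._≟_ (window-at b 2F) (window-at (next (next b)) 2F)))

  no-L11-labeling-with-5-labels : ¬ HasL11Labeling Strip 4
  no-L11-labeling-with-5-labels (l , valid) =
    RainbowChain.centres-not-7-periodic top bottom centre rainbow consecutive-centres-≢ periodic
    where
    adj? : Decidable (Adj Strip)
    adj? = ×ᴳ-adj? {Path (3 + M)} {Cycle 14} path-adj? cycle-adj?

    adj-sym : Symmetric (Adj Strip)
    adj-sym = ×ᴳ-sym {Path (3 + M)} {Cycle 14} path-sym cycle-sym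

    neighbourhood : ℕ → Vector (V Strip) 5
    neighbourhood k = window-at (cyclic (k * 2))

    top bottom centre : ℕ → Fin 5
    top    k = l (neighbourhood k 0F)
    bottom k = l (neighbourhood k 1F)
    centre k = l (neighbourhood k 2F)

    window-labels : ∀ k i → RainbowChain.window top bottom centre k i ≡ l (neighbourhood k i)
    window-labels k 0F = refl
    window-labels k 1F = refl
    window-labels k 2F = refl
    window-labels k 3F = refl
    window-labels k 4F = refl

    rainbow : ∀ k → Injective _≡_ _≡_ (RainbowChain.window top bottom centre k)
    rainbow k {i} {j} eq =
      closed-neighbourhood⇒injective adj? adj-sym valid (neighbourhood k)
        (window-at-injective _ _ _) (window-at-centred (cyclic (k * 2)))
        (trans (sym (window-labels k i)) (trans eq (window-labels k j)))

    consecutive-centres-≢ : ∀ k → centre k ≢ centre (suc k)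
    consecutive-centres-≢ k = common-neighbour⇒label≢ adj? adj-sym valid (consecutive-centres-distinct b)
      (inj₂ refl , next-adjacent (next b)) (inj₁ refl , next-adjacent (next (next b)))
      where b = cyclic (k * 2)

    periodic : ∀ k → centre (7 + k) ≡ centre k
    periodic k = cong (λ b → l (1F , next b)) (cyclic-periodic (k * 2))

mainTheorem14 : ∀ (m : ℕ) → 3 ≤ m → λ₁¹≡ (Path m ×ᴳ Cycle 14) 5
mainTheorem14 1 (s≤s ())
mainTheorem14 2 (s≤s (s≤s ()))
mainTheorem14 m@(suc (suc (suc M))) _ =
  (stripLabel , stripLabel-valid m) ,
  λ p p<5 → LowerBound.no-L11-labeling-with-5-labels M ∘ hasL11Labeling-mono (ℕ.s≤s⁻¹ p<5)
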